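{- Let $(A,R)$ be a countably infinite structure that is U-embedded in $(B,S)$ (with $R\subseteq A^k$, $S\subseteq B^k$), and let $\vec b\in S\setminus R$. Let $\vec a$ list some finite set $C$ with $A\cap\mathrm{Rng}(\vec b)\subseteq C\subseteq A$, and let $\tau(\vec x,\vec y)$ be the identity type of $\vec b\vec a$. Then there are infinitely many $k$-tuples $\vec a^{(1)},\vec a^{(2)},\dots\in R$ such that (1) every $\vec a^{(q)}$ satisfies $\tau(\vec a^{(q)},\vec a)$; (2) if $q\ne q'$ then $\mathrm{Rng}(\vec a^{(q)})\cap\mathrm{Rng}(\vec a^{(q')})\subseteq\mathrm{Rng}(\vec a)$.
   Context: For a tuple $\vec c=c_1\dots c_n$, $\mathrm{Rng}(\vec c)=\{c_1,\dots,c_n\}$; a tuple lists a finite set if it has no repetitions and its range is that set. The identity type of $\vec c$ is the formula $\tau(x_1,\dots,x_n)=\bigwedge_{c_i=c_j}x_i=x_j\wedge\bigwedge_{c_i\ne c_j}x_i\ne x_j$. A structure $(A,R)$ is U-embedded in $(B,S)$ if (1) $(A,R)$ is a substructure of $(B,S)$, and (2) for every finite tuple $\vec a$ of elements of $A$ and every first-order formula $\theta(\vec y,\vec z)$ over the empty signature, $(A,R)\models\forall\vec y(R\vec y\to\theta(\vec y,\vec a))$ implies $(B,S)\models\forall\vec y(S\vec y\to\theta(\vec y,\vec a))$. -}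

module Defs where

open import Data.Nat using (ℕ; suc; _+_)
open import Data.Fin using (Fin; zero; suc)
open import Data.Product using (Σ; ∃; _×_; _,_)
open import Data.Sum using (_⊎_)
open import Data.Empty using (⊥)
open import Relation.Nullary using (¬_)
open import Relation.Binary.PropositionalEquality using (_≡_; _≢_)
open import Data.Vec.Functional using (Vector; _++_)
open import Function.Bundles using (_⤖_; _⇔_)

-- First-order formulas over the EMPTY signature (only equality),
-- with free variables indexed by Fin n (de Bruijn style).
data Formula : ℕ → Set where
  _≐_  : ∀ {n} → Fin n → Fin n → Formula n
  ⊥ᶠ   : ∀ {n} → Formula n
  ¬ᶠ_  : ∀ {n} → Formula n → Formula n
  _∧ᶠ_ : ∀ {n} → Formula n → Formula n → Formula n
  _∨ᶠ_ : ∀ {n} → Formula n → Formula n → Formula n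
  _⇒ᶠ_ : ∀ {n} → Formula n → Formula n → Formula n
  ∀ᶠ   : ∀ {n} → Formula (suc n) → Formula n
  ∃ᶠ   : ∀ {n} → Formula (suc n) → Formula n

extend : ∀ {X : Set} {n} → X → (Fin n → X) → Fin (suc n) → X
extend x ρ zero    = x
extend x ρ (suc i) = ρ i

Sat : (X : Set) → ∀ {n} → Formula n → (Fin n → X) → Set
Sat X (i ≐ j)   ρ = ρ i ≡ ρ j
Sat X ⊥ᶠ        ρ = ⊥
Sat X (¬ᶠ φ)    ρ = ¬ Sat X φ ρ
Sat X (φ ∧ᶠ ψ)  ρ = Sat X φ ρ × Sat X ψ ρ
Sat X (φ ∨ᶠ ψ)  ρ = Sat X φ ρ ⊎ Sat X ψ ρ
Sat X (φ ⇒ᶠ ψ)  ρ = Sat X φ ρ → Sat X ψ ρ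
Sat X (∀ᶠ φ)    ρ = (x : X) → Sat X φ (extend x ρ)
Sat X (∃ᶠ φ)    ρ = Σ X λ x → Sat X φ (extend x ρ)

-- A structure (A,R) with R ⊆ A^k is given by a carrier A and a predicate R on k-tuples.
-- (A,R) sits inside (B,S) via an injection ι : A → B (A is identified with its image).

IsSubstructure : (k : ℕ) (A B : Set) (ι : A → B)
                 (R : Vector A k → Set) (S : Vector B k → Set) → Set
IsSubstructure k A B ι R S =
  (∀ a a′ → ι a ≡ ι a′ → a ≡ a′) ×
  (∀ (y : Vector A k) → R y ⇔ S (λ i → ι (y i)))

IsUEmbedded : (k : ℕ) (A B : Set) (ι : A → B)
              (R : Vector A k → Set) (S : Vector B k → Set) → Set
IsUEmbedded k A B ι R S =
  IsSubstructure k A B ι R S ×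
  (∀ (m : ℕ) (a : Vector A m) (θ : Formula (k + m)) →
     (∀ (y : Vector A k) → R y → Sat A θ (y ++ a)) →
     (∀ (y : Vector B k) → S y → Sat B θ (y ++ (λ i → ι (a i)))))

SatIdType : ∀ {X Y : Set} {n} → Vector X n → Vector Y n → Set
SatIdType c d = ∀ i j → (c i ≡ c j → d i ≡ d j) × (c i ≢ c j → d i ≢ d j)

CountablyInfinite : Set → Set
CountablyInfinite A = A ⤖ ℕ

{-# OPTIONS --safe #-}
-- Fix a finite tuple d of elements of A.  In B the tuple b satisfies, with parameters a and d,
-- τ(y, a) ∧ "every y_i equal to some d_j equals some a_l": the second conjunct holds because
-- A ∩ Rng b ⊆ Rng a.  Applying U-embeddedness to the negation of this formula yields an R-tuple
-- satisfying it.  Choosing each new tuple with d the concatenation of all earlier ones gives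
-- R-tuples of type τ whose ranges pairwise meet inside Rng a.  They are pairwise distinct: an
-- R-tuple of type τ with all entries in Rng a would, by τ, be mapped by ι onto b, but b ∉ R.
module Submission where

open import Defs
open import Level using (0ℓ)
open import Axiom.ExcludedMiddle using (ExcludedMiddle)
open import Axiom.DoubleNegationElimination using (em⇒dne)
open import Data.Nat using (ℕ; zero; suc; _+_; _*_; _<_; s≤s)
open import Data.Nat.Properties using (<-cmp; m≤n⇒m<n∨m≡n)
open import Data.Fin using (Fin; zero; suc; _↑ˡ_; _↑ʳ_; splitAt)
open import Data.Product using (Σ; ∃; _×_; _,_; proj₁; proj₂)
open import Data.Sum using (inj₁; inj₂; [_,_]′)
open import Data.Sum.Properties using ([,]-∘)
open import Function using (_∘_; _⇔_; mk⇔; Equivalence)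
open import Relation.Nullary using (¬_; Dec; yes; no; contradiction)
open import Relation.Binary using (tri<; tri≈; tri>)
open import Relation.Binary.PropositionalEquality
  using (_≡_; _≢_; _≗_; refl; sym; trans; cong; module ≡-Reasoning)
open import Data.Vec.Functional using (Vector; []; _++_)
open import Data.Vec.Functional.Properties using (lookup-++ˡ; lookup-++ʳ; ++-cong)

open Equivalence using (to; from)

infix 4 _∈ᵛ_ _⊆ᵛ_ _∩_⊆_

_∈ᵛ_ : ∀ {X : Set} {n} → X → Vector X n → Set
x ∈ᵛ v = ∃ λ i → v i ≡ x

_⊆ᵛ_ : ∀ {X : Set} {m n} → Vector X m → Vector X n → Set
u ⊆ᵛ v = ∀ {x} → x ∈ᵛ u → x ∈ᵛ v

_∩_⊆_ : ∀ {X : Set} {m n l} → Vector X m → Vector X n → Vector X l → Set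
u ∩ v ⊆ a = ∀ x → x ∈ᵛ u → x ∈ᵛ v → x ∈ᵛ a

module _ {X : Set} where

  ∈ᵛ-++⁺ˡ : ∀ {m n} {x : X} {u : Vector X m} (v : Vector X n) → x ∈ᵛ u → x ∈ᵛ u ++ v
  ∈ᵛ-++⁺ˡ {n = n} {u = u} v (i , ui≡x) = i ↑ˡ n , trans (lookup-++ˡ u v i) ui≡x

  ∈ᵛ-++⁺ʳ : ∀ {m n} {x : X} (u : Vector X m) {v : Vector X n} → x ∈ᵛ v → x ∈ᵛ u ++ v
  ∈ᵛ-++⁺ʳ {m} u {v} (j , vj≡x) = m ↑ʳ j , trans (lookup-++ʳ u v j) vj≡x

  ∈ᵛ-resp-≗ : ∀ {m} {x : X} {u u′ : Vector X m} → u ≗ u′ → x ∈ᵛ u → x ∈ᵛ u′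
  ∈ᵛ-resp-≗ u≗u′ (i , ui≡x) = i , trans (sym (u≗u′ i)) ui≡x

  module _ {m n l} {u : Vector X m} {v : Vector X n} {a : Vector X l} where

    ∩⊆-sym : u ∩ v ⊆ a → v ∩ u ⊆ a
    ∩⊆-sym meet x x∈v x∈u = meet x x∈u x∈v

    ∩⊆-monoʳ : ∀ {l′} {w : Vector X l′} → w ⊆ᵛ v → u ∩ v ⊆ a → u ∩ w ⊆ a
    ∩⊆-monoʳ w⊆v meet x x∈u x∈w = meet x x∈u (w⊆v x∈w)

    ∩⊆-resp-≗ : ∀ {u′ : Vector X m} {v′ : Vector X n} {a′ : Vector X l} →
                u ≗ u′ → v ≗ v′ → a ≗ a′ → u ∩ v ⊆ a → u′ ∩ v′ ⊆ a′
    ∩⊆-resp-≗ u≗u′ v≗v′ a≗a′ meet x x∈u′ x∈v′ =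
      ∈ᵛ-resp-≗ a≗a′ (meet x (∈ᵛ-resp-≗ (sym ∘ u≗u′) x∈u′) (∈ᵛ-resp-≗ (sym ∘ v≗v′) x∈v′))

∘-++ : ∀ {X Y : Set} {m n} (f : X → Y) (u : Vector X m) (v : Vector X n) →
       f ∘ (u ++ v) ≗ (f ∘ u) ++ (f ∘ v)
∘-++ {m = m} f u v i = [,]-∘ f (splitAt m i)

⋀ᶠ : ∀ {m M} → (Fin m → Formula M) → Formula M
⋀ᶠ {zero}  φ = ¬ᶠ ⊥ᶠ
⋀ᶠ {suc m} φ = φ zero ∧ᶠ ⋀ᶠ (φ ∘ suc)

⋁ᶠ : ∀ {m M} → (Fin m → Formula M) → Formula M
⋁ᶠ {zero}  φ = ⊥ᶠ
⋁ᶠ {suc m} φ = φ zero ∨ᶠ ⋁ᶠ (φ ∘ suc)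

module _ {X : Set} {M : ℕ} {ρ : Fin M → X} where

  ⋀ᶠ-intro : ∀ {m} {φ : Fin m → Formula M} → (∀ i → Sat X (φ i) ρ) → Sat X (⋀ᶠ φ) ρ
  ⋀ᶠ-intro {zero}  sat = λ ()
  ⋀ᶠ-intro {suc m} sat = sat zero , ⋀ᶠ-intro (sat ∘ suc)

  ⋀ᶠ-elim : ∀ {m} {φ : Fin m → Formula M} → Sat X (⋀ᶠ φ) ρ → ∀ i → Sat X (φ i) ρ
  ⋀ᶠ-elim {suc m} (sat , _)    zero    = sat
  ⋀ᶠ-elim {suc m} (_   , sats) (suc i) = ⋀ᶠ-elim sats i

  ⋁ᶠ-intro : ∀ {m} {φ : Fin m → Formula M} → ∃ (λ i → Sat X (φ i) ρ) → Sat X (⋁ᶠ φ) ρ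
  ⋁ᶠ-intro {suc m} (zero  , sat) = inj₁ sat
  ⋁ᶠ-intro {suc m} (suc i , sat) = inj₂ (⋁ᶠ-intro (i , sat))

  ⋁ᶠ-elim : ∀ {m} {φ : Fin m → Formula M} → Sat X (⋁ᶠ φ) ρ → ∃ λ i → Sat X (φ i) ρ
  ⋁ᶠ-elim {suc m} (inj₁ sat)  = zero , sat
  ⋁ᶠ-elim {suc m} (inj₂ sats) = let i , sat = ⋁ᶠ-elim sats in suc i , sat

extend-resp-≗ : ∀ {X : Set} {M} {ρ ρ′ : Fin M → X} (x : X) → ρ ≗ ρ′ → extend x ρ ≗ extend x ρ′
extend-resp-≗ x ρ≗ρ′ zero    = refl
extend-resp-≗ x ρ≗ρ′ (suc i) = ρ≗ρ′ i

Sat-resp-≗ : ∀ {X : Set} {M} (φ : Formula M) {ρ ρ′ : Fin M → X} → ρ ≗ ρ′ → Sat X φ ρ → Sat X φ ρ′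
Sat-resp-≗ (i ≐ j)  ρ≗ρ′ sat         = trans (sym (ρ≗ρ′ i)) (trans sat (ρ≗ρ′ j))
Sat-resp-≗ (¬ᶠ φ)   ρ≗ρ′ sat         = sat ∘ Sat-resp-≗ φ (sym ∘ ρ≗ρ′)
Sat-resp-≗ (φ ∧ᶠ ψ) ρ≗ρ′ (sat , sat′) = Sat-resp-≗ φ ρ≗ρ′ sat , Sat-resp-≗ ψ ρ≗ρ′ sat′
Sat-resp-≗ (φ ∨ᶠ ψ) ρ≗ρ′ (inj₁ sat)  = inj₁ (Sat-resp-≗ φ ρ≗ρ′ sat)
Sat-resp-≗ (φ ∨ᶠ ψ) ρ≗ρ′ (inj₂ sat)  = inj₂ (Sat-resp-≗ ψ ρ≗ρ′ sat)
Sat-resp-≗ (φ ⇒ᶠ ψ) ρ≗ρ′ sat         = Sat-resp-≗ ψ ρ≗ρ′ ∘ sat ∘ Sat-resp-≗ φ (sym ∘ ρ≗ρ′)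
Sat-resp-≗ (∀ᶠ φ)   ρ≗ρ′ sat x       = Sat-resp-≗ φ (extend-resp-≗ x ρ≗ρ′) (sat x)
Sat-resp-≗ (∃ᶠ φ)   ρ≗ρ′ (x , sat)   = x , Sat-resp-≗ φ (extend-resp-≗ x ρ≗ρ′) sat

literalᶠ : ∀ {P : Set} {M} → Dec P → Fin M → Fin M → Formula M
literalᶠ (yes _) i j = i ≐ j
literalᶠ (no _)  i j = ¬ᶠ (i ≐ j)

Sat-literalᶠ : ∀ {X P : Set} {M} (P? : Dec P) (i j : Fin M) {ρ : Fin M → X} →
               Sat X (literalᶠ P? i j) ρ ⇔ ((P → ρ i ≡ ρ j) × (¬ P → ρ i ≢ ρ j))
Sat-literalᶠ (yes p) i j = mk⇔ (λ sat → (λ _ → sat) , contradiction p) (λ (holds , _) → holds p)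
Sat-literalᶠ (no ¬p) i j = mk⇔ (λ sat → (λ p → contradiction p ¬p) , λ _ → sat) (λ (_ , fails) → fails ¬p)

module _ (em : ExcludedMiddle 0ℓ) {Y : Set} {m : ℕ} (c : Vector Y m) where

  idTypeᶠ : ∀ {M} → (Fin m → Fin M) → Formula M
  idTypeᶠ σ = ⋀ᶠ λ u → ⋀ᶠ λ v → literalᶠ (em {c u ≡ c v}) (σ u) (σ v)

  Sat-idTypeᶠ : ∀ {X : Set} {M} (σ : Fin m → Fin M) {ρ : Fin M → X} →
                Sat X (idTypeᶠ σ) ρ ⇔ SatIdType c (ρ ∘ σ)
  Sat-idTypeᶠ σ = mk⇔
    (λ sat u v → to (Sat-literalᶠ em (σ u) (σ v)) (⋀ᶠ-elim (⋀ᶠ-elim sat u) v))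
    (λ type → ⋀ᶠ-intro λ u → ⋀ᶠ-intro λ v → from (Sat-literalᶠ em (σ u) (σ v)) (type u v))

SatIdType-refl : ∀ {Y : Set} {m} {c : Vector Y m} → SatIdType c c
SatIdType-refl i j = (λ ci≡cj → ci≡cj) , (λ ci≢cj → ci≢cj)

module _ {X Y : Set} {m : ℕ} {c : Vector Y m} where

  SatIdType-resp-≗ : ∀ {e e′ : Vector X m} → e ≗ e′ → SatIdType c e → SatIdType c e′
  SatIdType-resp-≗ e≗e′ type i j =
    (λ ci≡cj → trans (sym (e≗e′ i)) (trans (proj₁ (type i j) ci≡cj) (e≗e′ j))) ,
    (λ ci≢cj e′i≡e′j → proj₂ (type i j) ci≢cj (trans (e≗e′ i) (trans e′i≡e′j (sym (e≗e′ j)))))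

  SatIdType-reflects-≡ : ExcludedMiddle 0ℓ → ∀ {e : Vector X m} → SatIdType c e →
                         ∀ {i j} → e i ≡ e j → c i ≡ c j
  SatIdType-reflects-≡ em type {i} {j} ei≡ej = em⇒dne em λ ci≢cj → proj₂ (type i j) ci≢cj ei≡ej

meetWithinᶠ : ∀ {M m n l} → (Fin m → Fin M) → (Fin n → Fin M) → (Fin l → Fin M) → Formula M
meetWithinᶠ uv vv av = ⋀ᶠ λ i → ⋀ᶠ λ j → (uv i ≐ vv j) ⇒ᶠ ⋁ᶠ λ l → av l ≐ vv j

Sat-meetWithinᶠ : ∀ {X : Set} {M m n l} (uv : Fin m → Fin M) (vv : Fin n → Fin M)
                  (av : Fin l → Fin M) {ρ : Fin M → X} →
                  Sat X (meetWithinᶠ uv vv av) ρ ⇔ (ρ ∘ uv ∩ ρ ∘ vv ⊆ ρ ∘ av)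
Sat-meetWithinᶠ uv vv av {ρ} = mk⇔
  (λ sat x (i , ui≡x) (j , vj≡x) →
     let l , al≡vj = ⋁ᶠ-elim (⋀ᶠ-elim (⋀ᶠ-elim sat i) j (trans ui≡x (sym vj≡x)))
     in  l , trans al≡vj vj≡x)
  (λ meet → ⋀ᶠ-intro λ i → ⋀ᶠ-intro λ j ui≡vj → ⋁ᶠ-intro (meet (ρ (vv j)) (i , ui≡vj) (j , refl)))

UEmbedded-reflects-∃ : ExcludedMiddle 0ℓ → ∀ {k} {A B : Set} {ι : A → B}
                       {R : Vector A k → Set} {S : Vector B k → Set} → IsUEmbedded k A B ι R S →
                       ∀ {m} (a : Vector A m) (φ : Formula (k + m)) →
                       (∃ λ y → S y × Sat B φ (y ++ ι ∘ a)) → ∃ λ y → R y × Sat A φ (y ++ a)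
UEmbedded-reflects-∃ em (_ , preserves) a φ (y , Sy , sat) =
  em⇒dne em λ none → preserves _ a (¬ᶠ φ) (λ y′ Ry′ sat′ → none (y′ , Ry′ , sat′)) y Sy sat

module Greedy {X : Set} {k : ℕ} (next : ∀ {p} → Vector X p → Vector X k) where

  history : ∀ q → Vector X (q * k)
  history zero    = []
  history (suc q) = next (history q) ++ history q

  greedy : ℕ → Vector X k
  greedy q = next (history q)

  greedy⊆history : ∀ {q q′} → q < q′ → greedy q ⊆ᵛ history q′
  greedy⊆history {q} {suc q′} (s≤s q≤q′) with m≤n⇒m<n∨m≡n q≤q′
  ... | inj₁ q<q′ = ∈ᵛ-++⁺ʳ (greedy q′) ∘ greedy⊆history q<q′
  ... | inj₂ refl = ∈ᵛ-++⁺ˡ (history q)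

  greedy-∩⊆ : ∀ {l} {a : Vector X l} → (∀ {p} (d : Vector X p) → next d ∩ d ⊆ a) →
              ∀ q q′ → q ≢ q′ → greedy q ∩ greedy q′ ⊆ a
  greedy-∩⊆ fresh q q′ q≢q′ with <-cmp q q′
  ... | tri< q<q′ _ _ = ∩⊆-sym (∩⊆-monoʳ (greedy⊆history q<q′) (fresh (history q′)))
  ... | tri≈ _ q≡q′ _ = contradiction q≡q′ q≢q′
  ... | tri> _ _ q′<q = ∩⊆-monoʳ (greedy⊆history q′<q) (fresh (history q))

module Layout (k n p : ℕ) where

  yv : Fin k → Fin (k + (n + p))
  yv i = i ↑ˡ (n + p)

  av : Fin n → Fin (k + (n + p))
  av l = k ↑ʳ (l ↑ˡ p)

  dv : Fin p → Fin (k + (n + p))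
  dv j = k ↑ʳ (n ↑ʳ j)

  yav : Fin (k + n) → Fin (k + (n + p))
  yav u = [ yv , av ]′ (splitAt k u)

  module _ {X : Set} (y : Vector X k) (a : Vector X n) (d : Vector X p) where

    lookup-yv : (y ++ (a ++ d)) ∘ yv ≗ y
    lookup-yv = lookup-++ˡ y (a ++ d)

    lookup-av : (y ++ (a ++ d)) ∘ av ≗ a
    lookup-av l = trans (lookup-++ʳ y (a ++ d) (l ↑ˡ p)) (lookup-++ˡ a d l)

    lookup-dv : (y ++ (a ++ d)) ∘ dv ≗ d
    lookup-dv j = trans (lookup-++ʳ y (a ++ d) (n ↑ʳ j)) (lookup-++ʳ a d j)

    lookup-yav : (y ++ (a ++ d)) ∘ yav ≗ y ++ a
    lookup-yav u with splitAt k u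
    ... | inj₁ i = lookup-yv i
    ... | inj₂ l = lookup-av l

  freshCopyᶠ : ExcludedMiddle 0ℓ → ∀ {Y : Set} → Vector Y (k + n) → Formula (k + (n + p))
  freshCopyᶠ em c = idTypeᶠ em c yav ∧ᶠ meetWithinᶠ yv dv av

  Sat-freshCopyᶠ : (em : ExcludedMiddle 0ℓ) {X Y : Set} (c : Vector Y (k + n))
                   (y : Vector X k) (a : Vector X n) (d : Vector X p) →
                   Sat X (freshCopyᶠ em c) (y ++ (a ++ d)) ⇔ (SatIdType c (y ++ a) × y ∩ d ⊆ a)
  Sat-freshCopyᶠ em c y a d = mk⇔
    (λ (type , meet) →
       SatIdType-resp-≗ (lookup-yav y a d) (to (Sat-idTypeᶠ em c yav) type) ,
       ∩⊆-resp-≗ (lookup-yv y a d) (lookup-dv y a d) (lookup-av y a d)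
                 (to (Sat-meetWithinᶠ yv dv av) meet))
    (λ (type , meet) →
       from (Sat-idTypeᶠ em c yav) (SatIdType-resp-≗ (sym ∘ lookup-yav y a d) type) ,
       from (Sat-meetWithinᶠ yv dv av)
            (∩⊆-resp-≗ (sym ∘ lookup-yv y a d) (sym ∘ lookup-dv y a d) (sym ∘ lookup-av y a d) meet))

module _ (em : ExcludedMiddle 0ℓ) {k : ℕ} {A B : Set} (ι : A → B)
         (b : Vector B k) {n : ℕ} (a : Vector A n) where

  ι-agrees-with-b : ∀ {y : Vector A k} → SatIdType (b ++ ι ∘ a) (y ++ a) →
                    ∀ {i l} → a l ≡ y i → ι (y i) ≡ b i
  ι-agrees-with-b {y} type {i} {l} al≡yi = begin
    ι (y i)              ≡⟨ cong ι al≡yi ⟨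
    ι (a l)              ≡⟨ lookup-++ʳ b (ι ∘ a) l ⟨
    (b ++ ι ∘ a) (k ↑ʳ l) ≡⟨ SatIdType-reflects-≡ em type same-entry ⟨
    (b ++ ι ∘ a) (i ↑ˡ n) ≡⟨ lookup-++ˡ b (ι ∘ a) i ⟩
    b i                  ∎
    where
    open ≡-Reasoning
    same-entry : (y ++ a) (i ↑ˡ n) ≡ (y ++ a) (k ↑ʳ l)
    same-entry = trans (lookup-++ˡ y a i) (trans (sym al≡yi) (sym (lookup-++ʳ y a l)))

  fresh-copy : ∀ {R : Vector A k → Set} {S : Vector B k → Set} → IsUEmbedded k A B ι R S → S b →
               (∀ x i → ι x ≡ b i → x ∈ᵛ a) →
               ∀ {p} (d : Vector A p) → ∃ λ y → R y × SatIdType (b ++ ι ∘ a) (y ++ a) × y ∩ d ⊆ a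
  fresh-copy embedded Sb covered {p} d =
    let y , Ry , sat = UEmbedded-reflects-∃ em embedded (a ++ d) φ (b , Sb , φ-at-b)
    in  y , Ry , to (Sat-freshCopyᶠ em (b ++ ι ∘ a) y a d) sat
    where
    open Layout k n p
    φ : Formula (k + (n + p))
    φ = freshCopyᶠ em (b ++ ι ∘ a)
    b∩d⊆a : b ∩ ι ∘ d ⊆ ι ∘ a
    b∩d⊆a x (i , bi≡x) (j , ιdj≡x) =
      let l , al≡dj = covered (d j) i (trans ιdj≡x (sym bi≡x))
      in  l , trans (cong ι al≡dj) ιdj≡x
    φ-at-b : Sat B φ (b ++ ι ∘ (a ++ d))
    φ-at-b = Sat-resp-≗ φ (++-cong b b (λ _ → refl) (sym ∘ ∘-++ ι a d))
               (from (Sat-freshCopyᶠ em (b ++ ι ∘ a) b (ι ∘ a) (ι ∘ d)) (SatIdType-refl , b∩d⊆a))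

lemma1 : ExcludedMiddle 0ℓ →
    (k : ℕ) (A B : Set) (ι : A → B)
    (R : Vector A k → Set) (S : Vector B k → Set) →
    CountablyInfinite A →
    IsUEmbedded k A B ι R S →
    (b : Vector B k) → S b →
    ¬ (Σ (Vector A k) λ y → R y × (∀ i → ι (y i) ≡ b i)) →
    (n : ℕ) (a : Vector A n) →
    (∀ l l′ → a l ≡ a l′ → l ≡ l′) →
    (∀ (x : A) (i : Fin k) → ι x ≡ b i → ∃ λ l → a l ≡ x) →
    Σ (ℕ → Vector A k) λ seq →
      (∀ q q′ → q ≢ q′ → ¬ (∀ i → seq q i ≡ seq q′ i)) ×
      (∀ q → R (seq q)) ×
      (∀ q → SatIdType (b ++ (λ l → ι (a l))) (seq q ++ a)) ×
      (∀ q q′ → q ≢ q′ → ∀ (x : A) →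
         (∃ λ i → seq q i ≡ x) → (∃ λ i → seq q′ i ≡ x) → ∃ λ l → a l ≡ x)
lemma1 em k A B ι R S _ embedded b Sb b∉R n a _ covered =
  greedy , distinct , R-greedy , type-greedy , meet
  where
  copy : ∀ {p} (d : Vector A p) → ∃ λ y → R y × SatIdType (b ++ ι ∘ a) (y ++ a) × y ∩ d ⊆ a
  copy = fresh-copy em ι b a embedded Sb covered

  open Greedy (λ d → proj₁ (copy d))

  R-greedy : ∀ q → R (greedy q)
  R-greedy q = let _ , Ry , _ = copy (history q) in Ry

  type-greedy : ∀ q → SatIdType (b ++ ι ∘ a) (greedy q ++ a)
  type-greedy q = let _ , _ , type , _ = copy (history q) in type

  meet : ∀ q q′ → q ≢ q′ → greedy q ∩ greedy q′ ⊆ a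
  meet = greedy-∩⊆ λ d → let _ , _ , _ , y∩d⊆a = copy d in y∩d⊆a

  distinct : ∀ q q′ → q ≢ q′ → ¬ (∀ i → greedy q i ≡ greedy q′ i)
  distinct q q′ q≢q′ same = b∉R (greedy q′ , R-greedy q′ , λ i →
    ι-agrees-with-b em ι b a (type-greedy q′) (proj₂ (meet q q′ q≢q′ _ (i , same i) (i , refl))))
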